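{- Let $n$ be a positive integer and $s \geq 9$ an integer, and let $$g_1(x) = n!\sum_{j=0}^{n}\binom{n+s-j}{n-j}\frac{x^j}{j!}.$$ Assume that $g_1(x)$ factors over $\mathbb{Q}$ as a product of a polynomial of degree $1$ and an irreducible polynomial. Let $p$ be a prime dividing $n$ with $s < p^2$. Then $$d + \left[\frac{s}{p}\right] \geq p,$$ where $d$ is the integer with $1 \leq d < p$ and $d \equiv \frac{n}{p} \pmod p$.
   Context: $[\alpha]$ denotes the largest integer not exceeding the real number $\alpha$. $g_1(x)$ is a monic polynomial of degree $n$ with integer coefficients. -}

module Defs where

open import Data.Nat using (ℕ; zero; suc; _≤_; _<_; _∸_)
open import Data.Nat.Combinatorics using (_C_)
open import Data.Nat.DivMod using (_/_)
open import Data.Nat.Base using (_!; _+_; _*_)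
open import Data.Integer using (+_)
open import Data.Rational using (ℚ; 0ℚ) renaming (_+_ to _+ℚ_; _*_ to _*ℚ_; _/_ to _/ℚ_)
open import Data.List using (List; []; _∷_; map; applyUpTo)
open import Data.Nat.Properties using (_!≢0)
open import Relation.Binary.PropositionalEquality using (_≡_)
open import Relation.Nullary using (¬_)
open import Data.Product using (_×_)
open import Data.Sum using (_⊎_)

-- Polynomials over ℚ as coefficient lists, constant term first.
Poly : Set
Poly = List ℚ

coeff : Poly → ℕ → ℚ
coeff []      _       = 0ℚ
coeff (a ∷ f) zero    = a
coeff (a ∷ f) (suc k) = coeff f k

addP : Poly → Poly → Poly
addP []      g       = g
addP f       []      = f
addP (a ∷ f) (b ∷ g) = (a +ℚ b) ∷ addP f g

mulP : Poly → Poly → Poly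
mulP []      g = []
mulP (a ∷ f) g = addP (map (a *ℚ_) g) (0ℚ ∷ mulP f g)

-- equality of polynomials (coefficientwise; trailing zeros irrelevant)
_≈P_ : Poly → Poly → Set
f ≈P g = ∀ k → coeff f k ≡ coeff g k

HasDegree : ℕ → Poly → Set
HasDegree d f = (¬ coeff f d ≡ 0ℚ) × (∀ k → d < k → coeff f k ≡ 0ℚ)

IsConstant : Poly → Set
IsConstant f = ∀ k → 1 ≤ k → coeff f k ≡ 0ℚ

Irreducible : Poly → Set
Irreducible f = (¬ IsConstant f) × (∀ u v → f ≈P mulP u v → IsConstant u ⊎ IsConstant v)

ℕtoℚ : ℕ → ℚ
ℕtoℚ k = (+ k) /ℚ 1

g₁coeff : ℕ → ℕ → ℕ → ℚ
g₁coeff n s j = ((+ ((n !) * ((n + s ∸ j) C (n ∸ j)))) /ℚ (j !)) {{j !≢0}}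

g₁ : ℕ → ℕ → Poly
g₁ n s = applyUpTo (g₁coeff n s) (suc n)

{-# OPTIONS --safe #-}
-- A linear factor of g₁ gives a root u/w in lowest terms of Σ_j N_j u^j w^(n−j) = 0, where
-- N_j = C(n+s−j, n−j)·(j+1)⋯n are the integral coefficients of g₁. Every N_j with j < n is a
-- multiple of n, hence of p, and N_n = 1, so p ∣ u and p ∤ w. With e = v_p(n!), each term with
-- j ≥ 1 is then divisible by p^(e+1) because v_p(j!) < j; hence so is N_0 w^n = n!·C(n+s, n)·w^n,
-- and p ∣ C(n+s, n). But if d + [s/p] < p, then for 1 ≤ t ≤ s the factors n + t and t of
-- (n+1)⋯(n+s) = C(n+s, n)·s! have the same p-adic valuation (for t = ip, n + t = (n/p + i)p with
-- 0 < d + i < p), so p ∤ C(n+s, n).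
module Submission where

module PAdic where

  open import Data.Nat.Base
    using (ℕ; zero; suc; _+_; _*_; _∸_; _^_; _!; _≤_; _<_; z≤n; s≤s; z<s; NonZero; nonTrivial⇒n>1)
  open import Data.Nat.Properties
  open import Data.Nat.Divisibility
  open import Data.Nat.Primality using (Prime; euclidsLemma; prime⇒nonZero; prime⇒nonTrivial)
  open import Data.Nat.Tactic.RingSolver using (solve; solve-∀)
  open import Algebra.Properties.CommutativeSemigroup *-commutativeSemigroup
    using (x∙yz≈y∙xz) renaming (interchange to *-interchange)
  open import Algebra.Properties.CommutativeSemigroup +-commutativeSemigroup
    using () renaming (xy∙z≈y∙xz to +-rearrange)
  open import Data.Nat.DivMod using (_/_; _%_; m≡m%n+[m/n]*n; m/n*n≡m; m*n/n≡m; /-monoˡ-≤)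
  open import Data.Nat.Combinatorics using (_C_; nCk≡n!/k![n-k]!; k![n∸k]!∣n!)
  open import Data.List.Base using (_∷_; [])
  open import Data.Empty using (⊥-elim)
  open import Data.Product using (∃-syntax; _×_; _,_)
  open import Data.Sum using (inj₁; inj₂; [_,_]′)
  open import Function using (id)
  open import Data.Nat.Induction using (<-rec)
  open import Relation.Nullary using (¬_; yes; no)
  open import Relation.Binary.PropositionalEquality

  private variable a b e i j k m n s t x y : ℕ

  record HasValuation (p x a : ℕ) : Set where
    constructor valuation
    field
      unit     : ℕ
      factors  : x ≡ p ^ a * unit
      p∤unit   : ¬ p ∣ unit

  risingFactorial : ℕ → ℕ → ℕ
  risingFactorial x zero    = 1
  risingFactorial x (suc k) = (x + k) * risingFactorial x k

  [j+k]!≡risingFactorial*j! : ∀ j k → (j + k) ! ≡ risingFactorial (suc j) k * j !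
  [j+k]!≡risingFactorial*j! j zero    = trans (cong _! (+-identityʳ j)) (sym (+-identityʳ (j !)))
  [j+k]!≡risingFactorial*j! j (suc k) = begin
    (j + suc k) !                                 ≡⟨ cong _! (+-suc j k) ⟩
    suc (j + k) * (j + k) !                       ≡⟨ cong (suc (j + k) *_) ([j+k]!≡risingFactorial*j! j k) ⟩
    suc (j + k) * (risingFactorial (suc j) k * j !) ≡⟨ *-assoc (suc (j + k)) (risingFactorial (suc j) k) (j !) ⟨
    risingFactorial (suc j) (suc k) * j !         ∎
    where open ≡-Reasoning

  nCk*k!*[n∸k]!≡n! : k ≤ n → (n C k) * (k ! * (n ∸ k) !) ≡ n !
  nCk*k!*[n∸k]!≡n! {k} {n} k≤n = trans (cong (_* (k ! * (n ∸ k) !)) (nCk≡n!/k![n-k]! k≤n))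
    (m/n*n≡m {{k !* (n ∸ k) !≢0}} (k![n∸k]!∣n! k≤n))

  [n+s]Cn*s!≡risingFactorial : ∀ n s → ((n + s) C n) * s ! ≡ risingFactorial (suc n) s
  [n+s]Cn*s!≡risingFactorial n s = *-cancelʳ-≡ _ _ (n !) {{n !≢0}} (begin
    c * s ! * n !                 ≡⟨ *-assoc c (s !) (n !) ⟩
    c * (s ! * n !)               ≡⟨ cong (c *_) (*-comm (s !) (n !)) ⟩
    c * (n ! * s !)               ≡⟨ cong (λ t → c * (n ! * t !)) (m+n∸m≡n n s) ⟨
    c * (n ! * (n + s ∸ n) !)     ≡⟨ nCk*k!*[n∸k]!≡n! (m≤m+n n s) ⟩
    (n + s) !                     ≡⟨ [j+k]!≡risingFactorial*j! n s ⟩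
    risingFactorial (suc n) s * n ! ∎)
    where
    open ≡-Reasoning
    c = (n + s) C n

  module _ {p : ℕ} (p-prime : Prime p) where

    private instance
      p≢0 : NonZero p
      p≢0 = prime⇒nonZero p-prime

    p^≢0 : ∀ k → NonZero (p ^ k)
    p^≢0 k = m^n≢0 p k

    1<p : 1 < p
    1<p = nonTrivial⇒n>1 p {{prime⇒nonTrivial p-prime}}

    ¬∣1 : ¬ p ∣ 1
    ¬∣1 p∣1 = <-irrefl (sym (∣1⇒≡1 p∣1)) 1<p

    ¬∣-* : ¬ p ∣ m → ¬ p ∣ n → ¬ p ∣ m * n
    ¬∣-* p∤m p∤n p∣mn = [ p∤m , p∤n ]′ (euclidsLemma _ _ p-prime p∣mn)

    ∣^⇒∣ : ∀ k → p ∣ m ^ k → p ∣ m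
    ∣^⇒∣ zero    p∣1 = ⊥-elim (¬∣1 p∣1)
    ∣^⇒∣ (suc k) p∣m^k+1 = [ id , ∣^⇒∣ k ]′ (euclidsLemma _ _ p-prime p∣m^k+1)

    ¬∣-between : 0 < m → m < p → ¬ p ∣ m
    ¬∣-between {suc _} _ m<p p∣m = <⇒≱ m<p (∣⇒≤ p∣m)

    ^-monoʳ-∣ : m ≤ n → p ^ m ∣ p ^ n
    ^-monoʳ-∣ {m} {n} m≤n = divides (p ^ (n ∸ m)) (begin
      p ^ n               ≡⟨ cong (p ^_) (m+[n∸m]≡n m≤n) ⟨
      p ^ (m + (n ∸ m))   ≡⟨ ^-distribˡ-+-* p m (n ∸ m) ⟩
      p ^ m * p ^ (n ∸ m) ≡⟨ *-comm (p ^ m) _ ⟩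
      p ^ (n ∸ m) * p ^ m ∎)
      where open ≡-Reasoning

    ^∣-cancelʳ : ∀ k → ¬ p ∣ y → p ^ k ∣ x * y → p ^ k ∣ x
    ^∣-cancelʳ zero    _   _ = 1∣ _
    ^∣-cancelʳ {y} {x} (suc k) p∤y p^k+1∣xy
      with euclidsLemma x y p-prime (∣-trans (m∣m*n (p ^ k)) p^k+1∣xy)
    ... | inj₂ p∣y = ⊥-elim (p∤y p∣y)
    ... | inj₁ (divides x′ refl) = subst (p * p ^ k ∣_) (*-comm p x′) (*-monoʳ-∣ p p^k∣x′)
      where
      x′py≡p[x′y] : x′ * p * y ≡ p * (x′ * y)
      x′py≡p[x′y] = solve (x′ ∷ p ∷ y ∷ [])
      p^k∣x′ : p ^ k ∣ x′
      p^k∣x′ = ^∣-cancelʳ k p∤y (*-cancelˡ-∣ p (subst (p * p ^ k ∣_) x′py≡p[x′y] p^k+1∣xy))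

    valuation-0 : ¬ p ∣ x → HasValuation p x 0
    valuation-0 {x} p∤x = valuation x (sym (*-identityˡ x)) p∤x

    valuation-0⁻¹ : HasValuation p x 0 → ¬ p ∣ x
    valuation-0⁻¹ (valuation x′ refl p∤x′) = subst (λ z → ¬ p ∣ z) (sym (*-identityˡ x′)) p∤x′

    valuation-* : HasValuation p x a → HasValuation p y b → HasValuation p (x * y) (a + b)
    valuation-* {a = a} {b = b} (valuation x′ refl p∤x′) (valuation y′ refl p∤y′) =
      valuation (x′ * y′) eq (¬∣-* p∤x′ p∤y′)
      where
      eq : p ^ a * x′ * (p ^ b * y′) ≡ p ^ (a + b) * (x′ * y′)
      eq = trans (*-interchange (p ^ a) x′ (p ^ b) y′) (cong (_* (x′ * y′)) (sym (^-distribˡ-+-* p a b)))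

    valuation⇒¬^∣ : HasValuation p x a → ¬ p ^ suc a ∣ x
    valuation⇒¬^∣ {a = a} (valuation x′ refl p∤x′) p^a+1∣x =
      p∤x′ (*-cancelˡ-∣ (p ^ a) {{p^≢0 a}} (subst (_∣ p ^ a * x′) (*-comm p (p ^ a)) p^a+1∣x))

    valuation-^ : ∀ k → HasValuation p (p ^ k) k
    valuation-^ k = valuation 1 (sym (*-identityʳ (p ^ k))) ¬∣1

    valuation-*p : ¬ p ∣ x → HasValuation p (x * p) 1
    valuation-*p {x} p∤x = valuation x (trans (*-comm x p) (cong (_* x) (sym (*-identityʳ p)))) p∤x

    valuation-≥ : HasValuation p x e → p ^ a ∣ x → a ≤ e
    valuation-≥ v p^a∣x = ≮⇒≥ (λ e<a → valuation⇒¬^∣ v (∣-trans (^-monoʳ-∣ e<a) p^a∣x))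

    valuation-unit-cancel : ¬ p ∣ y → ¬ p ∣ m → x * y ≡ p ^ e * m → HasValuation p x e
    valuation-unit-cancel {y} {m} {x} {e} p∤y p∤m xy≡p^em
      with ^∣-cancelʳ {x = x} e p∤y (divides m (trans xy≡p^em (*-comm (p ^ e) m)))
    ... | divides x′ refl = valuation x′ (*-comm x′ (p ^ e)) λ p∣x′ → p∤m (subst (p ∣_) x′y≡m (∣m⇒∣m*n y p∣x′))
      where
      x′y≡m : x′ * y ≡ m
      x′y≡m = *-cancelˡ-≡ _ _ (p ^ e) {{p^≢0 e}}
        (trans (sym (*-assoc (p ^ e) x′ y)) (trans (cong (_* y) (*-comm (p ^ e) x′)) xy≡p^em))

    valuation-cancelʳ : ∀ a → HasValuation p (x * y) (a + e) → HasValuation p y a → HasValuation p x e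
    valuation-cancelʳ {x} {e = e} a (valuation m xy≡p^[a+e]m p∤m) (valuation y′ refl p∤y′) =
      valuation-unit-cancel p∤y′ p∤m (*-cancelˡ-≡ _ _ (p ^ a) {{p^≢0 a}} (begin
        p ^ a * (x * y′)    ≡⟨ x∙yz≈y∙xz (p ^ a) x y′ ⟩
        x * (p ^ a * y′)    ≡⟨ xy≡p^[a+e]m ⟩
        p ^ (a + e) * m     ≡⟨ cong (_* m) (^-distribˡ-+-* p a e) ⟩
        p ^ a * p ^ e * m   ≡⟨ *-assoc (p ^ a) (p ^ e) m ⟩
        p ^ a * (p ^ e * m) ∎))
      where open ≡-Reasoning

    0<p : 0 < p
    0<p = <-trans z<s 1<p

    factorial-split : ∀ j → ∃[ m ] ∃[ r ] j ! ≡ p ^ m * m ! * r × ¬ p ∣ r × m * p ≤ j × j < suc m * p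
    factorial-split zero = 0 , 1 , refl , ¬∣1 , z≤n , subst (0 <_) (sym (+-identityʳ p)) 0<p
    factorial-split (suc j) with factorial-split j | p ∣? suc j
    ... | m , r , j!≡ , p∤r , mp≤j , j<[1+m]p | no p∤j+1 =
      m , suc j * r , eq , ¬∣-* p∤j+1 p∤r , m≤n⇒m≤1+n mp≤j ,
      ≤∧≢⇒< j<[1+m]p (λ j+1≡[1+m]p → p∤j+1 (divides (suc m) j+1≡[1+m]p))
      where
      eq : suc j ! ≡ p ^ m * m ! * (suc j * r)
      eq = trans (cong (suc j *_) j!≡) (x∙yz≈y∙xz (suc j) (p ^ m * m !) r)
    ... | m , r , j!≡ , p∤r , mp≤j , j<[1+m]p | yes (divides q j+1≡qp) =
      suc m , r , eq , p∤r , ≤-reflexive (sym j+1≡[1+m]p) ,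
      subst (_< suc (suc m) * p) (sym j+1≡[1+m]p) (m<n+m _ 0<p)
      where
      q≡1+m : q ≡ suc m
      q≡1+m = ≤-antisym (*-cancelʳ-≤ q (suc m) p (subst (_≤ suc m * p) j+1≡qp j<[1+m]p))
                        (*-cancelʳ-< _ m q (subst (m * p <_) j+1≡qp (s≤s mp≤j)))
      j+1≡[1+m]p : suc j ≡ suc m * p
      j+1≡[1+m]p = trans j+1≡qp (cong (_* p) q≡1+m)
      eq : suc j ! ≡ p ^ suc m * suc m ! * r
      eq = begin
        suc j * j !                          ≡⟨ cong₂ _*_ j+1≡[1+m]p j!≡ ⟩
        suc m * p * (p ^ m * m ! * r)        ≡⟨ rearrange (suc m) p (p ^ m) (m !) r ⟩
        p * p ^ m * (suc m * m !) * r        ∎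
        where
        open ≡-Reasoning
        rearrange : ∀ a b c d e → a * b * (c * d * e) ≡ b * c * (a * d) * e
        rearrange = solve-∀

    [1+m]p≤1+j⇒m+m<j : suc m * p ≤ suc j → m + m < j
    [1+m]p≤1+j⇒m+m<j {m} {j} [1+m]p≤1+j = ≤-pred (begin
      suc (suc (m + m)) ≡⟨ cong suc (+-suc m m) ⟨
      suc m + suc m     ≡⟨ cong (suc m +_) (+-identityʳ (suc m)) ⟨
      2 * suc m         ≤⟨ *-monoˡ-≤ (suc m) 1<p ⟩
      p * suc m         ≡⟨ *-comm p (suc m) ⟩
      suc m * p         ≤⟨ [1+m]p≤1+j ⟩
      suc j             ∎)
      where open ≤-Reasoning

    factorial-valuation : ∀ j → ∃[ a ] HasValuation p (suc j !) a × a ≤ j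
    factorial-valuation = <-rec _ step
      where
      step : ∀ j → (∀ {i} → i < j → ∃[ a ] HasValuation p (suc i !) a × a ≤ i) →
             ∃[ a ] HasValuation p (suc j !) a × a ≤ j
      step j rec with factorial-split (suc j)
      ... | zero , r , j!≡ , p∤r , _ , _ = 0 , valuation r j!≡ p∤r , z≤n
      ... | suc m , r , j!≡ , p∤r , [1+m]p≤1+j , _
        with m+m<j ← [1+m]p≤1+j⇒m+m<j {m} [1+m]p≤1+j
        with rec (≤-<-trans (m≤m+n m m) m+m<j)
      ... | a , v , a≤m =
        suc m + a + 0 ,
        subst (λ z → HasValuation p z (suc m + a + 0)) (sym j!≡)
          (valuation-* (valuation-* (valuation-^ (suc m)) v) (valuation-0 p∤r)) ,
        ≤-trans (≤-reflexive (+-identityʳ _)) (≤-trans (+-monoʳ-≤ (suc m) a≤m) m+m<j)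

    factorial-has-valuation : ∀ j → ∃[ a ] HasValuation p (j !) a
    factorial-has-valuation zero    = 0 , valuation-0 ¬∣1
    factorial-has-valuation (suc j) = let a , v , _ = factorial-valuation j in a , v

    p^[1+e]∣x*p^j : HasValuation p (x * y) e → HasValuation p y a → a < j → p ^ suc e ∣ x * p ^ j
    p^[1+e]∣x*p^j {x} {y} {e} {a} {j} vxy vy@(valuation y′ y≡p^ay′ _) a<j =
      ∣-trans (^-monoʳ-∣ 1+e≤r+j) (divides x′ x*p^j≡x′*p^[r+j])
      where
      a≤e : a ≤ e
      a≤e = valuation-≥ vxy (∣n⇒∣m*n x (divides y′ (trans y≡p^ay′ (*-comm (p ^ a) y′))))
      r = e ∸ a
      vx : HasValuation p x r
      vx = valuation-cancelʳ a (subst (HasValuation p (x * y)) (sym (m+[n∸m]≡n a≤e)) vxy) vy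
      x′ = HasValuation.unit vx
      1+e≤r+j : suc e ≤ r + j
      1+e≤r+j = begin
        suc e       ≡⟨ cong suc (m∸n+n≡m a≤e) ⟨
        suc (r + a) ≡⟨ +-suc r a ⟨
        r + suc a   ≤⟨ +-monoʳ-≤ r a<j ⟩
        r + j       ∎
        where open ≤-Reasoning
      x*p^j≡x′*p^[r+j] : x * p ^ j ≡ x′ * p ^ (r + j)
      x*p^j≡x′*p^[r+j] = begin
        x * p ^ j            ≡⟨ cong (_* p ^ j) (HasValuation.factors vx) ⟩
        p ^ r * x′ * p ^ j   ≡⟨ cong (_* p ^ j) (*-comm (p ^ r) x′) ⟩
        x′ * p ^ r * p ^ j   ≡⟨ *-assoc x′ (p ^ r) (p ^ j) ⟩
        x′ * (p ^ r * p ^ j) ≡⟨ cong (x′ *_) (^-distribˡ-+-* p r j) ⟨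
        x′ * p ^ (r + j)     ∎
        where open ≡-Reasoning

    ¬∣[k+i] : k % p + i < p → 0 < i → ¬ p ∣ k + i
    ¬∣[k+i] {k} {i} k%p+i<p 0<i p∣k+i =
      ¬∣-between (<-≤-trans 0<i (m≤n+m i (k % p))) k%p+i<p
        (∣m+n∣m⇒∣n (subst (p ∣_) k+i≡ p∣k+i) (n∣m*n (k / p)))
      where
      k+i≡ : k + i ≡ k / p * p + (k % p + i)
      k+i≡ = trans (cong (_+ i) (m≡m%n+[m/n]*n k p)) (+-rearrange (k % p) (k / p * p) i)

    module _ {n s : ℕ} (p∣n : p ∣ n) (no-carry : n / p % p + s / p < p) (s<p*p : s < p * p) where

      valuation[n+t]≡valuation[t] : 0 < t → t ≤ s → ∃[ b ] HasValuation p (n + t) b × HasValuation p t b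
      valuation[n+t]≡valuation[t] {t} 0<t t≤s with p ∣? t
      ... | no p∤t = 0 , valuation-0 (λ p∣n+t → p∤t (∣m+n∣m⇒∣n p∣n+t p∣n)) , valuation-0 p∤t
      ... | yes (divides (suc i) refl) =
        1 , subst (λ z → HasValuation p z 1) n+t≡[n/p+i]p (valuation-*p p∤n/p+i) , valuation-*p p∤i
        where
        i≤s/p : suc i ≤ s / p
        i≤s/p = subst (_≤ s / p) (m*n/n≡m (suc i) p) (/-monoˡ-≤ p t≤s)
        p∤i : ¬ p ∣ suc i
        p∤i = ¬∣-between z<s (*-cancelʳ-< p (suc i) p (≤-<-trans t≤s s<p*p))
        p∤n/p+i : ¬ p ∣ n / p + suc i
        p∤n/p+i = ¬∣[k+i] (≤-<-trans (+-monoʳ-≤ (n / p % p) i≤s/p) no-carry) z<s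
        n+t≡[n/p+i]p : (n / p + suc i) * p ≡ n + suc i * p
        n+t≡[n/p+i]p = trans (*-distribʳ-+ p (n / p) (suc i)) (cong (_+ suc i * p) (m/n*n≡m p∣n))

      valuation[risingFactorial]≡valuation[!] : t ≤ s →
        ∃[ a ] HasValuation p (risingFactorial (suc n) t) a × HasValuation p (t !) a
      valuation[risingFactorial]≡valuation[!] {zero} _ = 0 , valuation-0 ¬∣1 , valuation-0 ¬∣1
      valuation[risingFactorial]≡valuation[!] {suc t} t<s
        with valuation[risingFactorial]≡valuation[!] (<⇒≤ t<s) | valuation[n+t]≡valuation[t] z<s t<s
      ... | a , v[rising] , v[t!] | b , v[n+t] , v[t] =
        b + a ,
        subst (λ z → HasValuation p (z * risingFactorial (suc n) t) (b + a)) (+-suc n t) (valuation-* v[n+t] v[rising]) ,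
        valuation-* v[t] v[t!]

      ¬∣[n+s]Cn : ¬ p ∣ (n + s) C n
      ¬∣[n+s]Cn with valuation[risingFactorial]≡valuation[!] ≤-refl
      ... | a , v[rising] , v[s!] = valuation-0⁻¹ (valuation-cancelʳ a v[C*s!] v[s!])
        where
        v[C*s!] : HasValuation p (((n + s) C n) * s !) (a + 0)
        v[C*s!] = subst₂ (HasValuation p) (sym ([n+s]Cn*s!≡risingFactorial n s)) (sym (+-identityʳ a)) v[rising]

module RationalRoots where

  open import Defs
  open import Data.Nat.Base as ℕ using (ℕ; zero; suc; z≤n; s≤s)
  import Data.Nat.Properties as ℕ
  open import Data.Integer.Base as ℤ using (ℤ; +_; 0ℤ; 1ℤ)
  import Data.Integer.Properties as ℤ
  open import Data.Integer.Tactic.RingSolver using (solve-∀)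
  open import Data.Integer.Divisibility.Signed
    using (_∣_; divides; ∣m∣n⇒∣m+n; ∣m⇒∣m*n; ∣n⇒∣m*n; ∣m+n∣m⇒∣n; ∣m+n∣n⇒∣m)
  open import Data.Rational.Solver using (module +-*-Solver)
  open import Data.Rational.Base as ℚ using (ℚ; 0ℚ; _+_; _*_; -_; 1/_; ↥_; ↧_; toℚᵘ)
  import Data.Rational.Properties as ℚ
  open import Data.Rational.Unnormalised.Base as ℚᵘ using (mkℚᵘ; *≡*)
  import Data.Rational.Unnormalised.Properties as ℚᵘ
  open import Data.List.Base using (_∷_; []; map; applyUpTo)
  open import Data.Product using (∃-syntax; _,_)
  open import Data.Empty using (⊥-elim)
  open import Function using (_∘_; id)
  open import Data.Sum using ([_,_]′)
  open import Relation.Nullary using (contradiction)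
  open import Relation.Binary.PropositionalEquality
  import Algebra.Properties.CommutativeSemigroup as CommSemigroupProperties
  open import Algebra.Bundles using (CommutativeMonoid)
  open CommSemigroupProperties (CommutativeMonoid.commutativeSemigroup ℚ.*-1-commutativeMonoid)
    using (x∙yz≈y∙xz)
  open CommSemigroupProperties (CommutativeMonoid.commutativeSemigroup ℚ.+-0-commutativeMonoid)
    using () renaming (interchange to +-interchange)

  eval : Poly → ℚ → ℚ
  eval []      x = 0ℚ
  eval (c ∷ f) x = c + x * eval f x

  eval-addP : ∀ f g x → eval (addP f g) x ≡ eval f x + eval g x
  eval-addP []      g       x = sym (ℚ.+-identityˡ (eval g x))
  eval-addP (a ∷ f) []      x = sym (ℚ.+-identityʳ (a + x * eval f x))
  eval-addP (a ∷ f) (b ∷ g) x = begin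
    a + b + x * eval (addP f g) x          ≡⟨ cong (λ z → a + b + x * z) (eval-addP f g x) ⟩
    a + b + x * (eval f x + eval g x)      ≡⟨ cong (λ z → a + b + z) (ℚ.*-distribˡ-+ x (eval f x) (eval g x)) ⟩
    a + b + (x * eval f x + x * eval g x)  ≡⟨ +-interchange a b (x * eval f x) (x * eval g x) ⟩
    a + x * eval f x + (b + x * eval g x)  ∎
    where open ≡-Reasoning

  eval-map-* : ∀ c g x → eval (map (c *_) g) x ≡ c * eval g x
  eval-map-* c []      x = sym (ℚ.*-zeroʳ c)
  eval-map-* c (b ∷ g) x = begin
    c * b + x * eval (map (c *_) g) x ≡⟨ cong (λ z → c * b + x * z) (eval-map-* c g x) ⟩
    c * b + x * (c * eval g x)        ≡⟨ cong (λ z → c * b + z) (x∙yz≈y∙xz x c (eval g x)) ⟩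
    c * b + c * (x * eval g x)        ≡⟨ ℚ.*-distribˡ-+ c b (x * eval g x) ⟨
    c * (b + x * eval g x)            ∎
    where open ≡-Reasoning

  eval-mulP : ∀ f g x → eval (mulP f g) x ≡ eval f x * eval g x
  eval-mulP []      g x = sym (ℚ.*-zeroˡ (eval g x))
  eval-mulP (a ∷ f) g x = begin
    eval (addP (map (a *_) g) (0ℚ ∷ mulP f g)) x   ≡⟨ eval-addP (map (a *_) g) (0ℚ ∷ mulP f g) x ⟩
    eval (map (a *_) g) x + (0ℚ + x * eval (mulP f g) x)
      ≡⟨ cong₂ (λ u v → u + (0ℚ + x * v)) (eval-map-* a g x) (eval-mulP f g x) ⟩
    a * eval g x + (0ℚ + x * (eval f x * eval g x)) ≡⟨ cong (λ z → a * eval g x + z) (ℚ.+-identityˡ _) ⟩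
    a * eval g x + x * (eval f x * eval g x)        ≡⟨ cong (λ z → a * eval g x + z) (ℚ.*-assoc x (eval f x) (eval g x)) ⟨
    a * eval g x + x * eval f x * eval g x          ≡⟨ ℚ.*-distribʳ-+ (eval g x) a (x * eval f x) ⟨
    (a + x * eval f x) * eval g x                   ∎
    where open ≡-Reasoning

  eval-zero : ∀ f x → (∀ k → coeff f k ≡ 0ℚ) → eval f x ≡ 0ℚ
  eval-zero []      x _      = refl
  eval-zero (c ∷ f) x f≡0 = begin
    c + x * eval f x ≡⟨ cong₂ (λ u v → u + x * v) (f≡0 0) (eval-zero f x (f≡0 ∘ suc)) ⟩
    0ℚ + x * 0ℚ      ≡⟨ cong (λ z → 0ℚ + z) (ℚ.*-zeroʳ x) ⟩
    0ℚ               ∎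
    where open ≡-Reasoning

  eval-cong : ∀ f g x → f ≈P g → eval f x ≡ eval g x
  eval-cong []      g       x f≈g = sym (eval-zero g x (sym ∘ f≈g))
  eval-cong (a ∷ f) []      x f≈g = eval-zero (a ∷ f) x f≈g
  eval-cong (a ∷ f) (b ∷ g) x f≈g = cong₂ (λ u v → u + x * v) (f≈g 0) (eval-cong f g x (f≈g ∘ suc))

  eval-root-of-factor : ∀ f a b x → f ≈P mulP a b → eval a x ≡ 0ℚ → eval f x ≡ 0ℚ
  eval-root-of-factor f a b x f≈ab a[x]≡0 = begin
    eval f x              ≡⟨ eval-cong f (mulP a b) x f≈ab ⟩
    eval (mulP a b) x     ≡⟨ eval-mulP a b x ⟩
    eval a x * eval b x   ≡⟨ cong (_* eval b x) a[x]≡0 ⟩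
    0ℚ * eval b x         ≡⟨ ℚ.*-zeroˡ (eval b x) ⟩
    0ℚ                    ∎
    where open ≡-Reasoning

  hasDegree1⇒root : ∀ f → HasDegree 1 f → ∃[ ρ ] eval f ρ ≡ 0ℚ
  hasDegree1⇒root []                 (a₁≢0 , _)   = ⊥-elim (a₁≢0 refl)
  hasDegree1⇒root (a₀ ∷ [])          (a₁≢0 , _)   = ⊥-elim (a₁≢0 refl)
  hasDegree1⇒root (a₀ ∷ a₁ ∷ rest) (a₁≢0 , high≡0) = ρ , (begin
    a₀ + ρ * (a₁ + ρ * eval rest ρ)   ≡⟨ cong (λ z → a₀ + ρ * (a₁ + ρ * z)) rest≡0 ⟩
    a₀ + ρ * (a₁ + ρ * 0ℚ)            ≡⟨ cong (λ z → a₀ + ρ * (a₁ + z)) (ℚ.*-zeroʳ ρ) ⟩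
    a₀ + ρ * (a₁ + 0ℚ)                ≡⟨ cong (λ z → a₀ + ρ * z) (ℚ.+-identityʳ a₁) ⟩
    a₀ + ρ * a₁                       ≡⟨ cong (λ z → a₀ + z) (ℚ.neg-distribˡ-* (a₀ * 1/ a₁) a₁) ⟨
    a₀ + - (a₀ * 1/ a₁ * a₁)          ≡⟨ cong (λ z → a₀ + - z) (ℚ.*-assoc a₀ (1/ a₁) a₁) ⟩
    a₀ + - (a₀ * (1/ a₁ * a₁))        ≡⟨ cong (λ z → a₀ + - (a₀ * z)) (ℚ.*-inverseˡ a₁) ⟩
    a₀ + - (a₀ * ℚ.1ℚ)                ≡⟨ cong (λ z → a₀ + - z) (ℚ.*-identityʳ a₀) ⟩
    a₀ + - a₀                         ≡⟨ ℚ.+-inverseʳ a₀ ⟩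
    0ℚ                                ∎)
    where
    open ≡-Reasoning
    instance
      a₁-nonZero : ℚ.NonZero a₁
      a₁-nonZero = ℚ.≢-nonZero a₁≢0
    ρ = - (a₀ * 1/ a₁)
    rest≡0 : eval rest ρ ≡ 0ℚ
    rest≡0 = eval-zero rest ρ (λ k → high≡0 (suc (suc k)) (s≤s (s≤s z≤n)))

  fromℤ : ℤ → ℚ
  fromℤ i = i ℚ./ 1

  toℚᵘ-fromℤ : ∀ i → toℚᵘ (fromℤ i) ℚᵘ.≃ mkℚᵘ i 0
  toℚᵘ-fromℤ i = ℚ.toℚᵘ-fromℚᵘ (mkℚᵘ i 0)

  fromℤ-homo-+ : ∀ i j → fromℤ (i ℤ.+ j) ≡ fromℤ i + fromℤ j
  fromℤ-homo-+ i j = ℚ.toℚᵘ-injective (begin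
    toℚᵘ (fromℤ (i ℤ.+ j))              ≈⟨ toℚᵘ-fromℤ (i ℤ.+ j) ⟩
    mkℚᵘ (i ℤ.+ j) 0                    ≈⟨ *≡* ([i+j]1≡[i1+j1]1 i j) ⟩
    mkℚᵘ i 0 ℚᵘ.+ mkℚᵘ j 0               ≈⟨ ℚᵘ.+-cong (toℚᵘ-fromℤ i) (toℚᵘ-fromℤ j) ⟨
    toℚᵘ (fromℤ i) ℚᵘ.+ toℚᵘ (fromℤ j)   ≈⟨ ℚ.toℚᵘ-homo-+ (fromℤ i) (fromℤ j) ⟨
    toℚᵘ (fromℤ i + fromℤ j)            ∎)
    where
    open ℚᵘ.≃-Reasoning
    [i+j]1≡[i1+j1]1 : ∀ i j → (i ℤ.+ j) ℤ.* 1ℤ ≡ (i ℤ.* 1ℤ ℤ.+ j ℤ.* 1ℤ) ℤ.* 1ℤ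
    [i+j]1≡[i1+j1]1 = solve-∀

  fromℤ-homo-* : ∀ i j → fromℤ (i ℤ.* j) ≡ fromℤ i * fromℤ j
  fromℤ-homo-* i j = ℚ.toℚᵘ-injective (begin
    toℚᵘ (fromℤ (i ℤ.* j))              ≈⟨ toℚᵘ-fromℤ (i ℤ.* j) ⟩
    mkℚᵘ (i ℤ.* j) 0                    ≈⟨ *≡* refl ⟩
    mkℚᵘ i 0 ℚᵘ.* mkℚᵘ j 0               ≈⟨ ℚᵘ.*-cong (toℚᵘ-fromℤ i) (toℚᵘ-fromℤ j) ⟨
    toℚᵘ (fromℤ i) ℚᵘ.* toℚᵘ (fromℤ j)   ≈⟨ ℚ.toℚᵘ-homo-* (fromℤ i) (fromℤ j) ⟨
    toℚᵘ (fromℤ i * fromℤ j)            ∎)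
    where open ℚᵘ.≃-Reasoning

  fromℤ-injective : ∀ {i j} → fromℤ i ≡ fromℤ j → i ≡ j
  fromℤ-injective {i} {j} eq
    with ℚᵘ.≃-trans (ℚᵘ.≃-sym (toℚᵘ-fromℤ i)) (ℚᵘ.≃-trans (ℚ.toℚᵘ-cong eq) (toℚᵘ-fromℤ j))
  ... | *≡* i*1≡j*1 = trans (sym (ℤ.*-identityʳ i)) (trans i*1≡j*1 (ℤ.*-identityʳ j))

  +[x*m]/m≡fromℤ : ∀ x m .{{_ : ℕ.NonZero m}} → (+ (x ℕ.* m)) ℚ./ m ≡ fromℤ (+ x)
  +[x*m]/m≡fromℤ x (suc m) = ℚ.toℚᵘ-injective (begin
    toℚᵘ ((+ (x ℕ.* suc m)) ℚ./ suc m) ≈⟨ ℚ.toℚᵘ-fromℚᵘ (mkℚᵘ (+ (x ℕ.* suc m)) m) ⟩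
    mkℚᵘ (+ (x ℕ.* suc m)) m          ≈⟨ *≡* (trans (ℤ.*-identityʳ _) (ℤ.pos-* x (suc m))) ⟩
    mkℚᵘ (+ x) 0                      ≈⟨ toℚᵘ-fromℤ (+ x) ⟨
    toℚᵘ (fromℤ (+ x))                ∎)
    where open ℚᵘ.≃-Reasoning

  q*↧q≡↥q : ∀ q → q * fromℤ (↧ q) ≡ fromℤ (↥ q)
  q*↧q≡↥q q@(ℚ.mkℚ u d-1 _) = ℚ.toℚᵘ-injective (begin
    toℚᵘ (q * fromℤ (↧ q))               ≈⟨ ℚ.toℚᵘ-homo-* q (fromℤ (↧ q)) ⟩
    toℚᵘ q ℚᵘ.* toℚᵘ (fromℤ (↧ q))       ≈⟨ ℚᵘ.*-congˡ {toℚᵘ q} (toℚᵘ-fromℤ (↧ q)) ⟩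
    mkℚᵘ u d-1 ℚᵘ.* mkℚᵘ (+ suc d-1) 0   ≈⟨ *≡* (trans (ℤ.*-identityʳ _) (cong (λ z → u ℤ.* + z) (sym (ℕ.*-identityʳ _)))) ⟩
    mkℚᵘ u 0                             ≈⟨ toℚᵘ-fromℤ u ⟨
    toℚᵘ (fromℤ (↥ q))                   ∎)
    where open ℚᵘ.≃-Reasoning

  module _ (u w : ℤ) where

    -- homogenisation f m = Σ_{j<m} f j · u^j · w^(m−1−j)
    homogenisation : (ℕ → ℤ) → ℕ → ℤ
    homogenisation f zero    = 0ℤ
    homogenisation f (suc m) = f 0 ℤ.* w ℤ.^ m ℤ.+ u ℤ.* homogenisation (f ∘ suc) m

    homogenisation-suc : ∀ f m → homogenisation f (suc m) ≡ w ℤ.* homogenisation f m ℤ.+ f m ℤ.* u ℤ.^ m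
    homogenisation-suc f zero = swap (f 0) u w
      where
      swap : ∀ a u w → a ℤ.* 1ℤ ℤ.+ u ℤ.* 0ℤ ≡ w ℤ.* 0ℤ ℤ.+ a ℤ.* 1ℤ
      swap = solve-∀
    homogenisation-suc f (suc m) = begin
      f 0 ℤ.* w ℤ.^ suc m ℤ.+ u ℤ.* homogenisation (f ∘ suc) (suc m)
        ≡⟨ cong (λ h → f 0 ℤ.* w ℤ.^ suc m ℤ.+ u ℤ.* h) (homogenisation-suc (f ∘ suc) m) ⟩
      f 0 ℤ.* w ℤ.^ suc m ℤ.+ u ℤ.* (w ℤ.* homogenisation (f ∘ suc) m ℤ.+ f (suc m) ℤ.* u ℤ.^ m)
        ≡⟨ expand (f 0) w (w ℤ.^ m) u (homogenisation (f ∘ suc) m) (f (suc m)) (u ℤ.^ m) ⟩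
      w ℤ.* (f 0 ℤ.* w ℤ.^ m ℤ.+ u ℤ.* homogenisation (f ∘ suc) m) ℤ.+ f (suc m) ℤ.* u ℤ.^ suc m ∎
      where
      open ≡-Reasoning
      expand : ∀ a w wᵐ u h b uᵐ → a ℤ.* (w ℤ.* wᵐ) ℤ.+ u ℤ.* (w ℤ.* h ℤ.+ b ℤ.* uᵐ) ≡
                                   w ℤ.* (a ℤ.* wᵐ ℤ.+ u ℤ.* h) ℤ.+ b ℤ.* (u ℤ.* uᵐ)
      expand = solve-∀

    ∣homogenisation : ∀ {d} f m → (∀ j → j ℕ.< m → d ∣ f j) → d ∣ homogenisation f m
    ∣homogenisation f zero    _    = divides 0ℤ refl
    ∣homogenisation f (suc m) d∣f =
      ∣m∣n⇒∣m+n (∣m⇒∣m*n (w ℤ.^ m) (d∣f 0 ℕ.z<s))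
                (∣n⇒∣m*n u (∣homogenisation (f ∘ suc) m (λ j j<m → d∣f (suc j) (s≤s j<m))))

    ∣u*homogenisation : ∀ {d} f m → (∀ j → j ℕ.< m → d ∣ f j ℤ.* u ℤ.^ suc j) → d ∣ u ℤ.* homogenisation f m
    ∣u*homogenisation f zero    _      = ∣n⇒∣m*n u (divides 0ℤ refl)
    ∣u*homogenisation f (suc m) d∣fuʲ =
      subst (_ ∣_) (sym u*h≡)
        (∣m∣n⇒∣m+n (∣n⇒∣m*n w (∣u*homogenisation f m (λ j j<m → d∣fuʲ j (ℕ.m<n⇒m<1+n j<m)))) (d∣fuʲ m ℕ.≤-refl))
      where
      distrib : ∀ u w h a uᵐ → u ℤ.* (w ℤ.* h ℤ.+ a ℤ.* uᵐ) ≡ w ℤ.* (u ℤ.* h) ℤ.+ a ℤ.* (u ℤ.* uᵐ)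
      distrib = solve-∀
      u*h≡ : u ℤ.* homogenisation f (suc m) ≡ w ℤ.* (u ℤ.* homogenisation f m) ℤ.+ f m ℤ.* u ℤ.^ suc m
      u*h≡ = trans (cong (u ℤ.*_) (homogenisation-suc f m)) (distrib u w (homogenisation f m) (f m) (u ℤ.^ m))

    homogenisation≡0⇒∣leading : ∀ {d} f m → homogenisation f (suc m) ≡ 0ℤ →
                                (∀ j → j ℕ.< m → d ∣ f j) → d ∣ f m ℤ.* u ℤ.^ m
    homogenisation≡0⇒∣leading f m root d∣f =
      ∣m+n∣m⇒∣n (subst (_ ∣_) (trans (sym root) (homogenisation-suc f m)) (divides 0ℤ refl))
                (∣n⇒∣m*n w (∣homogenisation f m d∣f))

    homogenisation≡0⇒∣constant : ∀ {d} f m → homogenisation f (suc m) ≡ 0ℤ →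
                                 (∀ j → j ℕ.< m → d ∣ f (suc j) ℤ.* u ℤ.^ suc j) → d ∣ f 0 ℤ.* w ℤ.^ m
    homogenisation≡0⇒∣constant f m root d∣fuʲ =
      ∣m+n∣n⇒∣m (subst (_ ∣_) (sym root) (divides 0ℤ refl)) (∣u*homogenisation (f ∘ suc) m d∣fuʲ)

    module _ {ρ : ℚ} (ρw≡u : ρ * fromℤ w ≡ fromℤ u) where

      w*homogenisation : ∀ f c m → (∀ j → j ℕ.< m → c j ≡ fromℤ (f j)) →
                         fromℤ w * fromℤ (homogenisation f m) ≡ fromℤ (w ℤ.^ m) * eval (applyUpTo c m) ρ
      w*homogenisation f c zero    _ = trans (ℚ.*-zeroʳ (fromℤ w)) (sym (ℚ.*-zeroʳ (fromℤ 1ℤ)))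
      w*homogenisation f c (suc m) c≡f = begin
        W * fromℤ (f 0 ℤ.* w ℤ.^ m ℤ.+ u ℤ.* homogenisation (f ∘ suc) m)
          ≡⟨ cong (W *_) (trans (fromℤ-homo-+ (f 0 ℤ.* w ℤ.^ m) (u ℤ.* h))
                                 (cong₂ _+_ (fromℤ-homo-* (f 0) (w ℤ.^ m)) (fromℤ-homo-* u h))) ⟩
        W * (F * Wᵐ + fromℤ u * H)  ≡⟨ cong (λ z → W * (F * Wᵐ + z * H)) ρw≡u ⟨
        W * (F * Wᵐ + ρ * W * H)      ≡⟨ expand ⟩
        W * Wᵐ * F + W * ρ * (W * H)  ≡⟨ cong (λ z → W * Wᵐ * F + W * ρ * z) induction-hypothesis ⟩
        W * Wᵐ * F + W * ρ * (Wᵐ * E) ≡⟨ factor ⟩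
        W * Wᵐ * (F + ρ * E)          ≡⟨ cong₂ (λ a b → a * (b + ρ * E)) (fromℤ-homo-* w (w ℤ.^ m)) (c≡f 0 ℕ.z<s) ⟨
        fromℤ (w ℤ.^ suc m) * (c 0 + ρ * E) ∎
        where
        open ≡-Reasoning
        open +-*-Solver
        W = fromℤ w
        Wᵐ = fromℤ (w ℤ.^ m)
        F = fromℤ (f 0)
        h = homogenisation (f ∘ suc) m
        H = fromℤ h
        E = eval (applyUpTo (c ∘ suc) m) ρ
        induction-hypothesis : W * H ≡ Wᵐ * E
        induction-hypothesis = w*homogenisation (f ∘ suc) (c ∘ suc) m (λ j j<m → c≡f (suc j) (s≤s j<m))
        expand : W * (F * Wᵐ + ρ * W * H) ≡ W * Wᵐ * F + W * ρ * (W * H)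
        expand = solve 5 (λ W F Wᵐ ρ H → W :* (F :* Wᵐ :+ ρ :* W :* H) := W :* Wᵐ :* F :+ W :* ρ :* (W :* H))
                         refl W F Wᵐ ρ H
        factor : W * Wᵐ * F + W * ρ * (Wᵐ * E) ≡ W * Wᵐ * (F + ρ * E)
        factor = solve 5 (λ W F Wᵐ ρ E → W :* Wᵐ :* F :+ W :* ρ :* (Wᵐ :* E) := W :* Wᵐ :* (F :+ ρ :* E))
                         refl W F Wᵐ ρ E

      root⇒homogenisation≡0 : w ≢ 0ℤ → ∀ f c m → (∀ j → j ℕ.< m → c j ≡ fromℤ (f j)) →
                              eval (applyUpTo c m) ρ ≡ 0ℚ → homogenisation f m ≡ 0ℤ
      root⇒homogenisation≡0 w≢0 f c m c≡f root =
        [ (λ w≡0 → contradiction w≡0 w≢0) , id ]′ (ℤ.i*j≡0⇒i≡0∨j≡0 w (fromℤ-injective (begin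
          fromℤ (w ℤ.* homogenisation f m)                ≡⟨ fromℤ-homo-* w (homogenisation f m) ⟩
          fromℤ w * fromℤ (homogenisation f m)            ≡⟨ w*homogenisation f c m c≡f ⟩
          fromℤ (w ℤ.^ m) * eval (applyUpTo c m) ρ        ≡⟨ cong (fromℤ (w ℤ.^ m) *_) root ⟩
          fromℤ (w ℤ.^ m) * 0ℚ                            ≡⟨ ℚ.*-zeroʳ (fromℤ (w ℤ.^ m)) ⟩
          0ℚ                                              ∎)))
        where open ≡-Reasoning

open import Defs
open PAdic
open RationalRoots
open import Data.Nat.Base using (ℕ; zero; suc; _+_; _*_; _∸_; _^_; _!; _≤_; _<_; z≤n; s≤s; NonZero)
open import Data.Nat.Properties
open import Data.Nat.Divisibility
open import Data.Nat.DivMod using (_/_; _%_; m<n⇒m%n≡m)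
open import Data.Nat.Combinatorics using (_C_)
open import Data.Nat.Primality using (Prime)
import Data.Nat.Coprimality as Coprimality
open import Data.Integer.Base as ℤ using (ℤ; +_; 0ℤ)
import Data.Integer.Properties as ℤ
open import Data.Integer.Divisibility.Signed as ℤ∣ using () renaming (_∣_ to _∣ℤ_)
open import Data.Rational.Base as ℚ using (0ℚ; mkℚ)
open import Data.Product using (Σ; _×_; _,_)
open import Function using (_∘_)
open import Relation.Nullary using (¬_)
open import Relation.Nullary.Decidable using (decidable-stable)
open import Relation.Binary.PropositionalEquality

private variable j n s : ℕ

pos-^ : ∀ a m → + (a ^ m) ≡ (+ a) ℤ.^ m
pos-^ a zero    = refl
pos-^ a (suc m) = trans (ℤ.pos-* a (a ^ m)) (cong (+ a ℤ.*_) (pos-^ a m))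

abs-^ : ∀ i m → ℤ.∣ i ℤ.^ m ∣ ≡ ℤ.∣ i ∣ ^ m
abs-^ i zero    = refl
abs-^ i (suc m) = trans (ℤ.abs-* i (i ℤ.^ m)) (cong (ℤ.∣ i ∣ *_) (abs-^ i m))

^-mono-∣ℤ : ∀ {i j} m → i ∣ℤ j → i ℤ.^ m ∣ℤ j ℤ.^ m
^-mono-∣ℤ zero    _   = ℤ∣.∣-refl
^-mono-∣ℤ {i} {j} (suc m) i∣j = ℤ∣.∣-trans (ℤ∣.*-monoʳ-∣ i (^-mono-∣ℤ m i∣j)) (ℤ∣.*-monoˡ-∣ (j ℤ.^ m) i∣j)

+d∣+x*u^j : ∀ {d x p u} j → d ∣ x * p ^ j → + p ∣ℤ u → + d ∣ℤ + x ℤ.* u ℤ.^ j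
+d∣+x*u^j {d} {x} {p} {u} j d∣xpʲ p∣u =
  ℤ∣.∣-trans (ℤ∣.∣ᵤ⇒∣ d∣xpʲ) (subst (_∣ℤ + x ℤ.* u ℤ.^ j) +xpʲ≡ (ℤ∣.*-monoʳ-∣ (+ x) (^-mono-∣ℤ j p∣u)))
  where
  +xpʲ≡ : + x ℤ.* (+ p) ℤ.^ j ≡ + (x * p ^ j)
  +xpʲ≡ = trans (cong (+ x ℤ.*_) (sym (pos-^ p j))) (sym (ℤ.pos-* x (p ^ j)))

g₁coeffℕ : ℕ → ℕ → ℕ → ℕ
g₁coeffℕ n s j = ((n + s ∸ j) C (n ∸ j)) * risingFactorial (suc j) (n ∸ j)

n!≡risingFactorial*j! : j ≤ n → n ! ≡ risingFactorial (suc j) (n ∸ j) * j !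
n!≡risingFactorial*j! {j} {n} j≤n = trans (cong _! (sym (m+[n∸m]≡n j≤n))) ([j+k]!≡risingFactorial*j! j (n ∸ j))

g₁coeff≡fromℤ : j ≤ n → g₁coeff n s j ≡ fromℤ (+ g₁coeffℕ n s j)
g₁coeff≡fromℤ {j} {n} {s} j≤n =
  trans (cong (λ z → ((+ z) ℚ./ j !) {{j !≢0}}) n!*C≡) (+[x*m]/m≡fromℤ (g₁coeffℕ n s j) (j !) {{j !≢0}})
  where
  c = (n + s ∸ j) C (n ∸ j)
  r = risingFactorial (suc j) (n ∸ j)
  n!*C≡ : n ! * c ≡ g₁coeffℕ n s j * j !
  n!*C≡ = begin
    n ! * c         ≡⟨ cong (_* c) (n!≡risingFactorial*j! j≤n) ⟩
    r * j ! * c     ≡⟨ *-comm (r * j !) c ⟩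
    c * (r * j !)   ≡⟨ *-assoc c r (j !) ⟨
    c * r * j !     ∎
    where open ≡-Reasoning

g₁coeffℕ-leading : ∀ n s → g₁coeffℕ n s n ≡ 1
g₁coeffℕ-leading n s rewrite n∸n≡0 n = refl

n∣g₁coeffℕ : j < n → n ∣ g₁coeffℕ n s j
n∣g₁coeffℕ {j} {n} {s} j<n =
  ∣n⇒∣m*n ((n + s ∸ j) C (n ∸ j)) (subst (λ k → n ∣ risingFactorial (suc j) k) (sym n∸j≡) n∣top-factor)
  where
  n∸j≡ : n ∸ j ≡ suc (n ∸ suc j)
  n∸j≡ = +-∸-assoc 1 j<n
  n∣top-factor : n ∣ (suc j + (n ∸ suc j)) * risingFactorial (suc j) (n ∸ suc j)
  n∣top-factor = ∣m⇒∣m*n _ (∣-reflexive (sym (m+[n∸m]≡n j<n)))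

module _ {p : ℕ} (p-prime : Prime p) where

  p^[1+e]∣g₁coeffℕ*p^j : ∀ {e} → HasValuation p (n !) e → j < n →
                         p ^ suc e ∣ g₁coeffℕ n s (suc j) * p ^ suc j
  p^[1+e]∣g₁coeffℕ*p^j {n} {j} {s} {e} v[n!] j<n with factorial-valuation p-prime j
  ... | a , v[j!] , a≤j = subst (p ^ suc e ∣_) (sym (*-assoc c r (p ^ suc j)))
    (∣n⇒∣m*n c (p^[1+e]∣x*p^j p-prime {x = r} v[rj!] v[j!] (s≤s a≤j)))
    where
    c = (n + s ∸ suc j) C (n ∸ suc j)
    r = risingFactorial (suc (suc j)) (n ∸ suc j)
    v[rj!] : HasValuation p (r * suc j !) e
    v[rj!] = subst (λ z → HasValuation p z e) (n!≡risingFactorial*j! j<n) v[n!]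

  module _ {n s : ℕ} {u w : ℤ} (root : homogenisation u w (+_ ∘ g₁coeffℕ n s) (suc n) ≡ 0ℤ) where

    p∣numerator : p ∣ n → + p ∣ℤ u
    p∣numerator p∣n = ℤ∣.∣ᵤ⇒∣ (∣^⇒∣ p-prime n (subst (p ∣_) (abs-^ u n) (ℤ∣.∣⇒∣ᵤ p∣uⁿ)))
      where
      p∣uⁿ : + p ∣ℤ u ℤ.^ n
      p∣uⁿ = subst (+ p ∣ℤ_) (trans (cong (λ c → + c ℤ.* u ℤ.^ n) (g₁coeffℕ-leading n s)) (ℤ.*-identityˡ _))
        (homogenisation≡0⇒∣leading u w (+_ ∘ g₁coeffℕ n s) n root
          (λ j j<n → ℤ∣.∣ᵤ⇒∣ (∣-trans p∣n (n∣g₁coeffℕ j<n))))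

    p∣[n+s]Cn : + p ∣ℤ u → ¬ p ∣ ℤ.∣ w ∣ → p ∣ (n + s) C n
    p∣[n+s]Cn p∣u p∤w with factorial-has-valuation p-prime n
    ... | e , v[n!] =
      decidable-stable (p ∣? ((n + s) C n)) λ p∤C → valuation⇒¬^∣ p-prime (v[N₀wⁿ] p∤C) p^[1+e]∣N₀wⁿ
      where
      N₀ = g₁coeffℕ n s 0
      p^[1+e]∣N₀wⁿ : p ^ suc e ∣ N₀ * ℤ.∣ w ∣ ^ n
      p^[1+e]∣N₀wⁿ = subst (p ^ suc e ∣_) (trans (ℤ.abs-* (+ N₀) (w ℤ.^ n)) (cong (N₀ *_) (abs-^ w n)))
        (ℤ∣.∣⇒∣ᵤ p^[1+e]∣ℤN₀wⁿ)
        where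
        p^[1+e]∣ℤN₀wⁿ : + (p ^ suc e) ∣ℤ + N₀ ℤ.* w ℤ.^ n
        p^[1+e]∣ℤN₀wⁿ = homogenisation≡0⇒∣constant u w (+_ ∘ g₁coeffℕ n s) n root
          (λ j j<n → +d∣+x*u^j {x = g₁coeffℕ n s (suc j)} {p = p} (suc j)
                       (p^[1+e]∣g₁coeffℕ*p^j {s = s} v[n!] j<n) p∣u)
      v[N₀wⁿ] : ¬ p ∣ (n + s) C n → HasValuation p (N₀ * ℤ.∣ w ∣ ^ n) e
      v[N₀wⁿ] p∤C = subst (HasValuation p (N₀ * ℤ.∣ w ∣ ^ n)) (+-identityʳ e)
        (valuation-* p-prime (valuation-* p-prime (valuation-0 p-prime p∤C) v[rising])
                             (valuation-0 p-prime (p∤w ∘ ∣^⇒∣ p-prime n)))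
        where
        v[rising] : HasValuation p (risingFactorial 1 n) e
        v[rising] = subst (λ z → HasValuation p z e)
          (trans (n!≡risingFactorial*j! {0} {n} z≤n) (*-identityʳ (risingFactorial 1 n))) v[n!]

g₁-has-no-root : ∀ {p n s} → Prime p → p ∣ n → ¬ p ∣ (n + s) C n → ∀ ρ → eval (g₁ n s) ρ ≢ 0ℚ
g₁-has-no-root {p} {n} {s} p-prime p∣n p∤C ρ@(mkℚ u d-1 coprime) root =
  p∤C (p∣[n+s]Cn p-prime {n} {s} H≡0 p∣u p∤w)
  where
  H≡0 : homogenisation u (+ suc d-1) (+_ ∘ g₁coeffℕ n s) (suc n) ≡ 0ℤ
  H≡0 = root⇒homogenisation≡0 u (+ suc d-1) {ρ} (q*↧q≡↥q ρ) (λ ()) (+_ ∘ g₁coeffℕ n s) (g₁coeff n s) (suc n)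
    (λ j j≤n → g₁coeff≡fromℤ {s = s} (≤-pred j≤n)) root
  p∣u : + p ∣ℤ u
  p∣u = p∣numerator p-prime {n} {s} H≡0 p∣n
  p∤w : ¬ p ∣ suc d-1
  p∤w p∣w = <-irrefl (sym (Coprimality.recompute coprime (ℤ∣.∣⇒∣ᵤ p∣u , p∣w))) (1<p p-prime)

lemma2p4 : (n s : ℕ) → 1 ≤ n → 9 ≤ s →
    Σ Poly (λ a → Σ Poly (λ b →
      HasDegree 1 a × Irreducible b × (g₁ n s ≈P mulP a b))) →
    (p : ℕ) .{{_ : NonZero p}} → Prime p → p ∣ n → s < p * p →
    (d : ℕ) → 1 ≤ d → d < p → d % p ≡ (n / p) % p →
    p ≤ d + s / p
lemma2p4 n s _ _ (a , b , deg₁ , _ , g₁≈ab) p p-prime p∣n s<p*p d _ d<p d%p≡n/p%p = ≮⇒≥ λ d+s/p<p →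
  let ρ , a[ρ]≡0 = hasDegree1⇒root a deg₁
      d≡n/p%p = trans (sym (m<n⇒m%n≡m d<p)) d%p≡n/p%p
      p∤C = ¬∣[n+s]Cn p-prime p∣n (subst (λ z → z + s / p < p) d≡n/p%p d+s/p<p) s<p*p
  in g₁-has-no-root p-prime p∣n p∤C ρ (eval-root-of-factor (g₁ n s) a b ρ g₁≈ab a[ρ]≡0)
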